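{- For every integer $k\geq 2$ there exists a finite, simple, connected graph of diameter $3$ and order $k+3^k$ which has metric dimension $k$ and exactly one metric basis.
   Context: For vertices $u,v$ of a connected graph $G$, $d(u,v)$ is the distance between them. For an ordered set $W=\{w_1,\dots,w_k\}\subseteq V(G)$ and $v\in V(G)$, $r(v|W)=(d(v,w_1),\dots,d(v,w_k))$. $W$ is a resolving set if distinct vertices have distinct representations $r(\cdot|W)$. A resolving set of minimum cardinality is a metric basis; its cardinality is the metric dimension $\beta(G)$. -}

module Defs where

open import Data.Nat using (ℕ; zero; suc; _≤_; _<_)
open import Data.Fin using (Fin)
open import Data.Fin.Subset using (Subset; _∈_; ∣_∣)
open import Data.Bool using (Bool; true; false)
open import Data.Product using (Σ; ∃; ∃-syntax; _×_; _,_)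
open import Relation.Nullary using (¬_)
open import Relation.Binary.PropositionalEquality using (_≡_)

record Graph (n : ℕ) : Set where
  field
    adj     : Fin n → Fin n → Bool
    adj-sym : ∀ u v → adj u v ≡ adj v u
    loopless : ∀ v → adj v v ≡ false
open Graph public

data Walk {n : ℕ} (G : Graph n) : Fin n → Fin n → ℕ → Set where
  nil  : ∀ {u} → Walk G u u zero
  cons : ∀ {u w v ℓ} → adj G u w ≡ true → Walk G w v ℓ → Walk G u v (suc ℓ)

Dist : ∀ {n} → Graph n → Fin n → Fin n → ℕ → Set
Dist G u v m = Walk G u v m × (∀ m′ → m′ < m → ¬ Walk G u v m′)

Connected : ∀ {n} → Graph n → Set
Connected G = ∀ u v → ∃[ m ] Walk G u v m

HasDiameter : ∀ {n} → Graph n → ℕ → Set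
HasDiameter G D =
  (∀ u v m → Dist G u v m → m ≤ D) × ∃[ u ] ∃[ v ] Dist G u v D

Resolving : ∀ {n} → Graph n → Subset n → Set
Resolving G W =
  ∀ u v → (∀ w → w ∈ W → ∀ m → Dist G u w m → Dist G v w m) → u ≡ v

MetricBasis : ∀ {n} → Graph n → Subset n → Set
MetricBasis G W = Resolving G W × (∀ W′ → Resolving G W′ → ∣ W ∣ ≤ ∣ W′ ∣)

MetricDimension : ∀ {n} → Graph n → ℕ → Set
MetricDimension G k = ∃[ W ] (MetricBasis G W × ∣ W ∣ ≡ k)

UniqueMetricBasis : ∀ {n} → Graph n → Set
UniqueMetricBasis G = ∃[ W ] (MetricBasis G W × (∀ W′ → MetricBasis G W′ → W′ ≡ W))

-- The graph has k landmark vertices and one vertex for every word c ∈ {0,1,2}ᵏ;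
-- landmark i is adjacent to the words with cᵢ = 0, and two distinct words are
-- adjacent when they differ by at most one in every coordinate.  The distance
-- from landmark i to the word c is then 1 + cᵢ, so the landmarks resolve the
-- graph, and all distances are at most 3.
--
-- In a graph of diameter at most 3, a resolving set W determines every vertex
-- outside W by a word in {1,2,3}^|W|, so n ≤ |W| + 3^|W|; here n = k + 3ᵏ forces
-- |W| ≥ k.  If |W| = k the encoding is a bijection, so every word is realised.
-- If W contained a non-landmark w, the 3^(k-1) words with entry 3 at w would be
-- realised by vertices at distance 3 from w, which are landmarks; but k < 3^(k-1).
module Submission where

open import Defs
open import Data.Bool using (true; false)
open import Data.Empty using (⊥)
open import Data.Fin using (Fin; zero; suc; toℕ; splitAt; join; _↑ˡ_; _≟_; finToFun; funToFin; combine; punchOut; punchIn)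
open import Data.Fin.Properties using (toℕ<n; toℕ-injective; splitAt-join; join-splitAt; funToFin-finToFin; finToFun-funToFin; injective⇒≤; any?; all?; punchOut-injective)
open import Data.Fin.Subset using (Subset; _∈_; _∉_; _⊆_; ⊤; ∣_∣; inside; outside) renaming (⊥ to ∅)
open import Data.Fin.Subset.Properties using (_∈?_; ⊆-antisym; p⊂q⇒∣p∣<∣q∣; ∣⊥∣≡0)
open import Data.Nat using (ℕ; zero; suc; pred; _+_; _^_; _≤_; _<_; _≤?_; z≤n; s≤s; s≤s⁻¹)
open import Data.Nat.Properties using (<-cmp; ≤-refl; ≤-reflexive; ≤-trans; ≤-antisym; <⇒≤; <⇒≱; n≤1+n; m≤n⇒m≤1+n; ≰⇒>; 1+n≰n; m≤m+n; +-suc; +-monoˡ-≤; +-monoʳ-≤; +-mono-<-≤; ^-monoʳ-≤; m^n>0; suc-injective; module ≤-Reasoning)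
open import Data.Product using (∃-syntax; _×_; _,_; proj₁; proj₂; swap)
open import Data.Sum using (_⊎_; inj₁; inj₂)
open import Data.Sum.Properties using (inj₁-injective; inj₂-injective)
open import Data.Vec using (_∷_; here; there; _++_)
open import Data.Vec.Functional using (updateAt; insertAt)
open import Data.Vec.Functional.Properties using (updateAt-updates; updateAt-minimal; updateAt-id-local; insertAt-lookup; insertAt-punchIn)
open import Function using (_∘_)
open import Function.Definitions using (Injective)
open import Relation.Binary using (tri<; tri≈; tri>)
open import Relation.Binary.PropositionalEquality
open import Relation.Nullary using (¬_; Dec; yes; no; does; ¬?; _×-dec_; contradiction)
open import Relation.Nullary.Decidable using (dec-true; dec-false; does-≡; map′)

n<3^pred[n] : ∀ {n} → 2 ≤ n → n < 3 ^ pred n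
n<3^pred[n] {suc (suc n)} (s≤s (s≤s z≤n)) = 2+n<3^[1+n] n
  where
  2+n<3^[1+n] : ∀ n → 2 + n < 3 ^ suc n
  2+n<3^[1+n] zero = ≤-refl
  2+n<3^[1+n] (suc n) = begin-strict
    3 + n                                   <⟨ s≤s (2+n<3^[1+n] n) ⟩
    1 + 3 ^ suc n                           ≤⟨ +-monoˡ-≤ (3 ^ suc n) (m^n>0 3 (suc n)) ⟩
    3 ^ suc n + 3 ^ suc n                   ≤⟨ +-monoʳ-≤ (3 ^ suc n) (m≤m+n (3 ^ suc n) _) ⟩
    3 ^ suc (suc n)                         ∎
    where open ≤-Reasoning

m+3^m≤n+3^n⇒m≤n : ∀ {m n} → m + 3 ^ m ≤ n + 3 ^ n → m ≤ n
m+3^m≤n+3^n⇒m≤n {m} {n} le with m ≤? n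
... | yes m≤n = m≤n
... | no m≰n = contradiction le (<⇒≱ (+-mono-<-≤ n<m (^-monoʳ-≤ 3 (<⇒≤ n<m))))
  where n<m = ≰⇒> m≰n

funToFin-cong : ∀ {m n} {f g : Fin m → Fin n} → (∀ i → f i ≡ g i) → funToFin f ≡ funToFin g
funToFin-cong {zero} _ = refl
funToFin-cong {suc m} f≗g = cong₂ combine (f≗g zero) (funToFin-cong (f≗g ∘ suc))

finToFun-injective : ∀ {m n} {c c′ : Fin (n ^ m)} →
  (∀ i → finToFun {n} {m} c i ≡ finToFun c′ i) → c ≡ c′
finToFun-injective {m} {n} {c} {c′} eq = begin
  c                               ≡⟨ sym (funToFin-finToFin {m} {n} c) ⟩
  funToFin (finToFun {n} {m} c)   ≡⟨ funToFin-cong eq ⟩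
  funToFin (finToFun {n} {m} c′)  ≡⟨ funToFin-finToFin {m} {n} c′ ⟩
  c′                              ∎
  where open ≡-Reasoning

funToFin-injective : ∀ {m n} {f g : Fin m → Fin n} → funToFin f ≡ funToFin g → ∀ i → f i ≡ g i
funToFin-injective {f = f} {g} eq i =
  trans (sym (finToFun-funToFin f i)) (trans (cong (λ c → finToFun c i) eq) (finToFun-funToFin g i))

join-injective : ∀ m n → Injective _≡_ _≡_ (join m n)
join-injective m n {x} {y} eq = trans (sym (splitAt-join m n x)) (trans (cong (splitAt m) eq) (splitAt-join m n y))

injective⇒surjective : ∀ {m n} {f : Fin m → Fin n} → Injective _≡_ _≡_ f → m ≡ n → ∀ y → ∃[ x ] f x ≡ y
injective⇒surjective {suc m} {f = f} f-injective refl y with any? (λ x → f x ≟ y)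
... | yes hit = hit
... | no miss = contradiction (injective⇒≤ f-avoiding-y-injective) 1+n≰n
  where
  f-avoiding-y : Fin (suc m) → Fin m
  f-avoiding-y x = punchOut {i = y} λ fx≡y → miss (x , sym fx≡y)
  f-avoiding-y-injective : Injective _≡_ _≡_ f-avoiding-y
  f-avoiding-y-injective eq = f-injective (punchOut-injective {i = y} _ _ eq)

injective-on-slice⇒≤ : ∀ {m b K} (p : Fin b) (d : Fin m) (R : (g : Fin b → Fin m) → g p ≡ d → Fin K) →
  (∀ {g g′} (gp : g p ≡ d) (g′p : g′ p ≡ d) → R g gp ≡ R g′ g′p → ∀ t → g t ≡ g′ t) →
  m ^ pred b ≤ K
injective-on-slice⇒≤ {m} {suc b} p d R R-injective = injective⇒≤ {f = R∘extend} R∘extend-injective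
  where
  extend : Fin (m ^ b) → Fin (suc b) → Fin m
  extend c = insertAt (finToFun c) p d
  R∘extend : Fin (m ^ b) → Fin _
  R∘extend c = R (extend c) (insertAt-lookup (finToFun c) p d)
  R∘extend-injective : Injective _≡_ _≡_ R∘extend
  R∘extend-injective {c} {c′} eq = finToFun-injective λ s → begin
    finToFun c s                ≡⟨ sym (insertAt-punchIn (finToFun c) p d s) ⟩
    extend c (punchIn p s)      ≡⟨ R-injective _ _ eq (punchIn p s) ⟩
    extend c′ (punchIn p s)     ≡⟨ insertAt-punchIn (finToFun c′) p d s ⟩
    finToFun c′ s               ∎
    where open ≡-Reasoning

enum : ∀ {n} (W : Subset n) → Fin ∣ W ∣ → Fin n
enum (inside ∷ W) zero = zero
enum (inside ∷ W) (suc t) = suc (enum W t)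
enum (outside ∷ W) t = suc (enum W t)

index : ∀ {n} (W : Subset n) {v : Fin n} → v ∈ W → Fin ∣ W ∣
index (inside ∷ W) here = zero
index (inside ∷ W) (there v∈W) = suc (index W v∈W)
index (outside ∷ W) (there v∈W) = index W v∈W

enum-index : ∀ {n} (W : Subset n) {v : Fin n} (v∈W : v ∈ W) → enum W (index W v∈W) ≡ v
enum-index (inside ∷ W) here = refl
enum-index (inside ∷ W) (there v∈W) = cong suc (enum-index W v∈W)
enum-index (outside ∷ W) (there v∈W) = cong suc (enum-index W v∈W)

index-injective : ∀ {n} (W : Subset n) {u v : Fin n} (u∈W : u ∈ W) (v∈W : v ∈ W) →
  index W u∈W ≡ index W v∈W → u ≡ v
index-injective W u∈W v∈W eq =
  trans (sym (enum-index W u∈W)) (trans (cong (enum W) eq) (enum-index W v∈W))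

⊆∧∣⊇∣⇒≡ : ∀ {n} {p q : Subset n} → p ⊆ q → ∣ q ∣ ≤ ∣ p ∣ → p ≡ q
⊆∧∣⊇∣⇒≡ {p = p} {q} p⊆q ∣q∣≤∣p∣ = ⊆-antisym p⊆q q⊆p
  where
  q⊆p : q ⊆ p
  q⊆p {x} x∈q with x ∈? p
  ... | yes x∈p = x∈p
  ... | no x∉p = contradiction ∣q∣≤∣p∣ (<⇒≱ (p⊂q⇒∣p∣<∣q∣ (p⊆q , x , x∈q , x∉p)))

↑ˡ∈⊤++ : ∀ {m n} (i : Fin m) (q : Subset n) → i ↑ˡ n ∈ ⊤ ++ q
↑ˡ∈⊤++ zero q = here
↑ˡ∈⊤++ (suc i) q = there (↑ˡ∈⊤++ i q)

∣⊤++∅∣ : ∀ m n → ∣ ⊤ {m} ++ ∅ {n} ∣ ≡ m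
∣⊤++∅∣ zero n = ∣⊥∣≡0 n
∣⊤++∅∣ (suc m) n = cong suc (∣⊤++∅∣ m n)

module _ {n : ℕ} (G : Graph n) where

  Walk-snoc : ∀ {u v w ℓ} → Walk G u v ℓ → adj G v w ≡ true → Walk G u w (suc ℓ)
  Walk-snoc nil e′ = cons e′ nil
  Walk-snoc (cons e p) e′ = cons e (Walk-snoc p e′)

  Walk-reverse : ∀ {u v ℓ} → Walk G u v ℓ → Walk G v u ℓ
  Walk-reverse nil = nil
  Walk-reverse (cons {u} {w} e p) = Walk-snoc (Walk-reverse p) (trans (adj-sym G w u) e)

  Walk₀⇒≡ : ∀ {u v} → Walk G u v 0 → u ≡ v
  Walk₀⇒≡ nil = refl

  Walk₁⇒adj : ∀ {u v} → Walk G u v 1 → adj G u v ≡ true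
  Walk₁⇒adj (cons e nil) = e

  Dist-sym : ∀ {u v m} → Dist G u v m → Dist G v u m
  Dist-sym (p , shortest) = Walk-reverse p , λ ℓ ℓ<m q → shortest ℓ ℓ<m (Walk-reverse q)

  Dist-unique : ∀ {u v m m′} → Dist G u v m → Dist G u v m′ → m ≡ m′
  Dist-unique {m = m} {m′} (p , shortest) (p′ , shortest′) with <-cmp m m′
  ... | tri< m<m′ _ _ = contradiction p (shortest′ m m<m′)
  ... | tri≈ _ m≡m′ _ = m≡m′
  ... | tri> _ _ m′<m = contradiction p′ (shortest m′ m′<m)

  Dist-refl : ∀ {u} → Dist G u u 0
  Dist-refl = nil , λ _ ()

  Dist-adj : ∀ {u v} → u ≢ v → adj G u v ≡ true → Dist G u v 1
  Dist-adj u≢v e = cons e nil , shorter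
    where
    shorter : ∀ ℓ → ℓ < 1 → ¬ Walk G _ _ ℓ
    shorter zero _ p = u≢v (Walk₀⇒≡ p)
    shorter (suc _) (s≤s ())

  Dist-common-neighbour : ∀ {u v w} → u ≢ v → adj G u v ≡ false →
    adj G u w ≡ true → adj G w v ≡ true → Dist G u v 2
  Dist-common-neighbour u≢v ¬e e₁ e₂ = cons e₁ (cons e₂ nil) , shorter
    where
    shorter : ∀ ℓ → ℓ < 2 → ¬ Walk G _ _ ℓ
    shorter zero _ p = u≢v (Walk₀⇒≡ p)
    shorter (suc zero) _ p with () ← trans (sym (Walk₁⇒adj p)) ¬e
    shorter (suc (suc _)) (s≤s (s≤s ()))

  module _ (f : Fin n → ℕ) (lipschitz : ∀ {u v} → adj G u v ≡ true → f v ≤ suc (f u)) where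

    walk-potential : ∀ {u v ℓ} → Walk G u v ℓ → f v ≤ f u + ℓ
    walk-potential {u} nil = m≤m+n (f u) 0
    walk-potential {u} {v} (cons {w = w} {ℓ = ℓ} e p) = begin
      f v            ≤⟨ walk-potential p ⟩
      f w + ℓ        ≤⟨ +-monoˡ-≤ ℓ (lipschitz e) ⟩
      suc (f u) + ℓ  ≡⟨ sym (+-suc (f u) ℓ) ⟩
      f u + suc ℓ    ∎
      where open ≤-Reasoning

    Dist-potential : ∀ {u v m} → f u ≡ 0 → f v ≡ m → Walk G u v m → Dist G u v m
    Dist-potential {u} {v} fu≡0 refl p = p , λ ℓ ℓ<fv q →
      <⇒≱ ℓ<fv (subst (λ x → f v ≤ x + ℓ) fu≡0 (walk-potential q))

module DistanceFunction {n : ℕ} (G : Graph n) (δ : Fin n → Fin n → ℕ)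
                        (dist : ∀ u v → Dist G u v (δ u v)) where

  Dist⇒≡δ : ∀ {u v m} → Dist G u v m → m ≡ δ u v
  Dist⇒≡δ d = Dist-unique G d (dist _ _)

  connected : Connected G
  connected u v = δ u v , proj₁ (dist u v)

  δ-refl : ∀ u → δ u u ≡ 0
  δ-refl u = sym (Dist⇒≡δ (Dist-refl G))

  δ≡0⇒≡ : ∀ {u v} → δ u v ≡ 0 → u ≡ v
  δ≡0⇒≡ {u} {v} eq = Walk₀⇒≡ G (subst (Walk G u v) eq (proj₁ (dist u v)))

  ≢⇒δ>0 : ∀ {u v} → u ≢ v → 0 < δ u v
  ≢⇒δ>0 {u} {v} u≢v with δ u v in eq
  ... | zero = contradiction (δ≡0⇒≡ eq) u≢v
  ... | suc _ = s≤s z≤n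

  δ-Resolving : Subset n → Set
  δ-Resolving W = ∀ u v → (∀ w → w ∈ W → δ u w ≡ δ v w) → u ≡ v

  δ-Resolving⇒Resolving : ∀ {W} → δ-Resolving W → Resolving G W
  δ-Resolving⇒Resolving separates u v agree =
    separates u v λ w w∈W → Dist⇒≡δ (agree w w∈W (δ u w) (dist u w))

  Resolving⇒δ-Resolving : ∀ {W} → Resolving G W → δ-Resolving W
  Resolving⇒δ-Resolving resolving u v agree = resolving u v λ w w∈W m d →
    subst (Dist G v w) (sym (trans (Dist⇒≡δ d) (agree w w∈W))) (dist v w)

  -- Distances 1, 2, 3 are recorded as the digits 0, 1, 2; other values are junk.
  digit : ℕ → Fin 3
  digit 1 = zero
  digit 2 = suc zero
  digit _ = suc (suc zero)

  suc-toℕ-digit : ∀ {m} → 0 < m → m ≤ 3 → suc (toℕ (digit m)) ≡ m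
  suc-toℕ-digit {1} _ _ = refl
  suc-toℕ-digit {2} _ _ = refl
  suc-toℕ-digit {3} _ _ = refl
  suc-toℕ-digit {suc (suc (suc (suc _)))} _ (s≤s (s≤s (s≤s ())))

  module Diameter≤3 (δ≤3 : ∀ u v → δ u v ≤ 3) (W : Subset n) (resolving : Resolving G W) where

    representation : Fin n → Fin ∣ W ∣ → Fin 3
    representation v t = digit (δ v (enum W t))

    δ-from-representation : ∀ {v w} (w∈W : w ∈ W) → v ∉ W →
      suc (toℕ (representation v (index W w∈W))) ≡ δ v w
    δ-from-representation {v} {w} w∈W v∉W = begin
      suc (toℕ (digit (δ v (enum W (index W w∈W)))))  ≡⟨ cong (suc ∘ toℕ ∘ digit ∘ δ v) (enum-index W w∈W) ⟩
      suc (toℕ (digit (δ v w)))                       ≡⟨ suc-toℕ-digit (≢⇒δ>0 λ { refl → v∉W w∈W }) (δ≤3 v w) ⟩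
      δ v w                                           ∎
      where open ≡-Reasoning

    representation-injective : ∀ {u v} → u ∉ W → v ∉ W →
      (∀ t → representation u t ≡ representation v t) → u ≡ v
    representation-injective {u} {v} u∉W v∉W same = Resolving⇒δ-Resolving resolving u v λ w w∈W →
      trans (sym (δ-from-representation w∈W u∉W))
            (trans (cong (suc ∘ toℕ) (same (index W w∈W))) (δ-from-representation w∈W v∉W))

    encode : Fin n → Fin ∣ W ∣ ⊎ Fin (3 ^ ∣ W ∣)
    encode v with v ∈? W
    ... | yes v∈W = inj₁ (index W v∈W)
    ... | no _ = inj₂ (funToFin (representation v))

    encode-injective : Injective _≡_ _≡_ encode
    encode-injective {u} {v} eq with u ∈? W | v ∈? W
    ... | yes u∈W | yes v∈W = index-injective W u∈W v∈W (inj₁-injective eq)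
    ... | no u∉W | no v∉W = representation-injective u∉W v∉W (funToFin-injective (inj₂-injective eq))
    encode-injective () | yes _ | no _
    encode-injective () | no _ | yes _

    encode≡inj₂ : ∀ v {g} → encode v ≡ inj₂ (funToFin g) → v ∉ W × (∀ t → representation v t ≡ g t)
    encode≡inj₂ v eq with v ∈? W
    encode≡inj₂ v () | yes _
    ... | no v∉W = v∉W , funToFin-injective (inj₂-injective eq)

    join∘encode-injective : Injective _≡_ _≡_ (join ∣ W ∣ _ ∘ encode)
    join∘encode-injective = encode-injective ∘ join-injective ∣ W ∣ _

    order≤ : n ≤ ∣ W ∣ + 3 ^ ∣ W ∣
    order≤ = injective⇒≤ join∘encode-injective

    representation-surjective : n ≡ ∣ W ∣ + 3 ^ ∣ W ∣ →
      ∀ g → ∃[ v ] (v ∉ W × (∀ t → representation v t ≡ g t))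
    representation-surjective n≡ g
      with v , eq ← injective⇒surjective join∘encode-injective n≡ (join ∣ W ∣ _ (inj₂ (funToFin g)))
      = v , encode≡inj₂ v (join-injective ∣ W ∣ _ eq)

    far-from-member-bound : n ≡ ∣ W ∣ + 3 ^ ∣ W ∣ → ∀ {w K} → w ∈ W → (e : Fin K → Fin n) →
      (∀ v → δ v w ≡ 3 → ∃[ j ] e j ≡ v) → 3 ^ pred ∣ W ∣ ≤ K
    far-from-member-bound n≡ {w} w∈W e covers = injective-on-slice⇒≤ p (suc (suc zero)) R R-injective
      where
      p = index W w∈W
      realiser : (Fin ∣ W ∣ → Fin 3) → Fin n
      realiser g = proj₁ (representation-surjective n≡ g)
      realiser-realises : ∀ g t → representation (realiser g) t ≡ g t
      realiser-realises g = proj₂ (proj₂ (representation-surjective n≡ g))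
      far : ∀ {g} → g p ≡ suc (suc zero) → δ (realiser g) w ≡ 3
      far {g} gp = trans (sym (δ-from-representation w∈W (proj₁ (proj₂ (representation-surjective n≡ g)))))
                         (cong (suc ∘ toℕ) (trans (realiser-realises g p) gp))
      R : (g : Fin ∣ W ∣ → Fin 3) → g p ≡ suc (suc zero) → Fin _
      R g gp = proj₁ (covers _ (far gp))
      R-injective : ∀ {g g′} gp g′p → R g gp ≡ R g′ g′p → ∀ t → g t ≡ g′ t
      R-injective {g} {g′} gp g′p eq t = begin
        g t                               ≡⟨ sym (realiser-realises g t) ⟩
        representation (realiser g) t     ≡⟨ cong (λ v → representation v t) same ⟩
        representation (realiser g′) t    ≡⟨ realiser-realises g′ t ⟩
        g′ t                              ∎
        where
        open ≡-Reasoning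
        same : realiser g ≡ realiser g′
        same = trans (sym (proj₂ (covers _ (far gp)))) (trans (cong e eq) (proj₂ (covers _ (far g′p))))

module Construction (k : ℕ) where

  Code : Set
  Code = Fin (3 ^ k)

  coord : Code → Fin k → Fin 3
  coord = finToFun

  Vertex : Set
  Vertex = Fin k ⊎ Code

  Close : Fin 3 → Fin 3 → Set
  Close a b = toℕ a ≤ suc (toℕ b) × toℕ b ≤ suc (toℕ a)

  Close-refl : ∀ a → Close a a
  Close-refl a = n≤1+n (toℕ a) , n≤1+n (toℕ a)

  Adjacent : Code → Code → Set
  Adjacent c c′ = c ≢ c′ × (∀ i → Close (coord c i) (coord c′ i))

  Edge : Vertex → Vertex → Set
  Edge (inj₁ _) (inj₁ _) = ⊥
  Edge (inj₁ i) (inj₂ c) = coord c i ≡ zero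
  Edge (inj₂ c) (inj₁ i) = coord c i ≡ zero
  Edge (inj₂ c) (inj₂ c′) = Adjacent c c′

  adjacent? : ∀ c c′ → Dec (Adjacent c c′)
  adjacent? c c′ = ¬? (c ≟ c′) ×-dec all? λ i →
    toℕ (coord c i) ≤? suc (toℕ (coord c′ i)) ×-dec toℕ (coord c′ i) ≤? suc (toℕ (coord c i))

  edge? : ∀ x y → Dec (Edge x y)
  edge? (inj₁ _) (inj₁ _) = no λ ()
  edge? (inj₁ i) (inj₂ c) = coord c i ≟ zero
  edge? (inj₂ c) (inj₁ i) = coord c i ≟ zero
  edge? (inj₂ c) (inj₂ c′) = adjacent? c c′

  Adjacent-sym : ∀ {c c′} → Adjacent c c′ → Adjacent c′ c
  Adjacent-sym (c≢c′ , close) = ≢-sym c≢c′ , swap ∘ close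

  Edge-sym : ∀ {x y} → Edge x y → Edge y x
  Edge-sym {inj₁ _} {inj₂ _} e = e
  Edge-sym {inj₂ _} {inj₁ _} e = e
  Edge-sym {inj₂ _} {inj₂ _} e = Adjacent-sym e

  Edge-irrefl : ∀ {x} → ¬ Edge x x
  Edge-irrefl {inj₂ _} (c≢c , _) = c≢c refl

  vertex : Vertex → Fin (k + 3 ^ k)
  vertex = join k (3 ^ k)

  view : Fin (k + 3 ^ k) → Vertex
  view = splitAt k

  landmark : Fin k → Fin (k + 3 ^ k)
  landmark i = vertex (inj₁ i)

  view-vertex : ∀ x → view (vertex x) ≡ x
  view-vertex = splitAt-join k (3 ^ k)

  view⇒≡vertex : ∀ {u x} → view u ≡ x → u ≡ vertex x
  view⇒≡vertex {u} eq = trans (sym (join-splitAt k (3 ^ k) u)) (cong vertex eq)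

  graph : Graph (k + 3 ^ k)
  graph = record
    { adj = λ u v → does (edge? (view u) (view v))
    ; adj-sym = λ u v → does-≡ (edge? (view u) (view v)) (map′ Edge-sym Edge-sym (edge? (view v) (view u)))
    ; loopless = λ v → dec-false (edge? (view v) (view v)) Edge-irrefl
    }

  adj⇒Edge : ∀ {u v} → adj graph u v ≡ true → Edge (view u) (view v)
  adj⇒Edge {u} {v} e with edge? (view u) (view v)
  ... | yes uv = uv

  Edge⇒adj : ∀ x y → Edge x y → adj graph (vertex x) (vertex y) ≡ true
  Edge⇒adj x y e = dec-true (edge? _ _) (subst₂ Edge (sym (view-vertex x)) (sym (view-vertex y)) e)

  ¬Edge⇒¬adj : ∀ x y → ¬ Edge x y → adj graph (vertex x) (vertex y) ≡ false
  ¬Edge⇒¬adj x y ¬e = dec-false (edge? _ _) (¬e ∘ subst₂ Edge (view-vertex x) (view-vertex y))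

  δ : Vertex → Vertex → ℕ
  δ (inj₁ i) (inj₁ j) with i ≟ j
  ... | yes _ = 0
  ... | no _ = 2
  δ (inj₁ i) (inj₂ c) = suc (toℕ (coord c i))
  δ (inj₂ c) (inj₁ i) = suc (toℕ (coord c i))
  δ (inj₂ c) (inj₂ c′) with c ≟ c′ | adjacent? c c′
  ... | yes _ | _ = 0
  ... | no _ | yes _ = 1
  ... | no _ | no _ = 2

  δ-landmark-refl : ∀ i → δ (inj₁ i) (inj₁ i) ≡ 0
  δ-landmark-refl i with i ≟ i
  ... | yes _ = refl
  ... | no i≢i = contradiction refl i≢i

  δ-landmark-lipschitz : ∀ i {x y} → Edge x y → δ (inj₁ i) y ≤ suc (δ (inj₁ i) x)
  δ-landmark-lipschitz i {inj₁ j} {inj₂ c} cj≡0 with i ≟ j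
  ... | yes refl = ≤-reflexive (cong (suc ∘ toℕ) cj≡0)
  ... | no _ = toℕ<n (coord c i)
  δ-landmark-lipschitz i {inj₂ c} {inj₁ j} _ with i ≟ j
  ... | yes _ = z≤n
  ... | no _ = s≤s (s≤s z≤n)
  δ-landmark-lipschitz i {inj₂ c} {inj₂ c′} (_ , close) = s≤s (proj₂ (close i))

  constant : Fin 3 → Code
  constant d = funToFin {k} λ _ → d

  coord-constant : ∀ d i → coord (constant d) i ≡ d
  coord-constant d = finToFun-funToFin {k} {3} λ _ → d

  _[_]≔_ : Code → Fin k → Fin 3 → Code
  c [ i ]≔ d = funToFin (updateAt (coord c) i λ _ → d)

  coord-[]≔ : ∀ c i d → coord (c [ i ]≔ d) i ≡ d
  coord-[]≔ c i d = trans (finToFun-funToFin _ i) (updateAt-updates i (coord c))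

  coord-[]≔-other : ∀ c i d {j} → j ≢ i → coord (c [ i ]≔ d) j ≡ coord c j
  coord-[]≔-other c i d {j} j≢i = trans (finToFun-funToFin _ j) (updateAt-minimal j i (coord c) j≢i)

  []≔-coord : ∀ c i → c [ i ]≔ coord c i ≡ c
  []≔-coord c i = finToFun-injective λ j → trans (finToFun-funToFin _ j) (updateAt-id-local i (coord c) refl j)

  []≔-adjacent : ∀ c i {a b} → a ≢ b → Close a b → Adjacent (c [ i ]≔ a) (c [ i ]≔ b)
  []≔-adjacent c i {a} {b} a≢b close = distinct , close-everywhere
    where
    distinct : c [ i ]≔ a ≢ c [ i ]≔ b
    distinct eq = a≢b (trans (sym (coord-[]≔ c i a)) (trans (cong (λ c′ → coord c′ i) eq) (coord-[]≔ c i b)))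
    close-everywhere : ∀ j → Close (coord (c [ i ]≔ a) j) (coord (c [ i ]≔ b) j)
    close-everywhere j with j ≟ i
    ... | yes refl = subst₂ Close (sym (coord-[]≔ c j a)) (sym (coord-[]≔ c j b)) close
    ... | no j≢i = subst₂ Close (sym (coord-[]≔-other c i a j≢i)) (sym (coord-[]≔-other c i b j≢i))
                          (Close-refl (coord c j))

  walk-from-landmark : ∀ i y → Walk graph (landmark i) (vertex y) (δ (inj₁ i) y)
  walk-from-landmark i (inj₁ j) with i ≟ j
  ... | yes refl = nil
  ... | no _ = cons (Edge⇒adj (inj₁ i) (inj₂ _) (coord-constant zero i))
                     (cons (Edge⇒adj (inj₂ _) (inj₁ j) (coord-constant zero j)) nil)
  walk-from-landmark i (inj₂ c) =
    subst (λ c′ → Walk graph (landmark i) (vertex (inj₂ c′)) (suc (toℕ (coord c i)))) ([]≔-coord c i)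
          (climb (coord c i))
    where
    start : Walk graph (landmark i) (vertex (inj₂ (c [ i ]≔ zero))) 1
    start = cons (Edge⇒adj (inj₁ i) (inj₂ _) (coord-[]≔ c i zero)) nil
    step : ∀ {a b} → a ≢ b → Close a b →
      adj graph (vertex (inj₂ (c [ i ]≔ a))) (vertex (inj₂ (c [ i ]≔ b))) ≡ true
    step a≢b close = Edge⇒adj (inj₂ _) (inj₂ _) ([]≔-adjacent c i a≢b close)
    climb : ∀ d → Walk graph (landmark i) (vertex (inj₂ (c [ i ]≔ d))) (suc (toℕ d))
    climb zero = start
    climb (suc zero) = Walk-snoc graph start (step (λ ()) (z≤n , s≤s z≤n))
    climb (suc (suc zero)) = Walk-snoc graph (Walk-snoc graph start (step (λ ()) (z≤n , s≤s z≤n)))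
                                              (step (λ ()) (s≤s z≤n , s≤s (s≤s z≤n)))

  landmark-Dist : ∀ i y → Dist graph (landmark i) (vertex y) (δ (inj₁ i) y)
  landmark-Dist i y =
    Dist-potential graph potential (δ-landmark-lipschitz i ∘ adj⇒Edge)
      (trans (cong (δ (inj₁ i)) (view-vertex (inj₁ i))) (δ-landmark-refl i))
      (cong (δ (inj₁ i)) (view-vertex y))
      (walk-from-landmark i y)
    where
    potential : Fin (k + 3 ^ k) → ℕ
    potential u = δ (inj₁ i) (view u)

  centre : Code
  centre = constant (suc zero)

  Adjacent-centre : ∀ {c} → c ≢ centre → Adjacent c centre
  Adjacent-centre {c} c≢centre = c≢centre , λ i →
    subst (Close (coord c i)) (sym (coord-constant _ i)) (s≤s⁻¹ (toℕ<n (coord c i)) , s≤s z≤n)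

  ¬Adjacent⇒≢centre : ∀ {c c′} → c ≢ c′ → ¬ Adjacent c c′ → c′ ≢ centre
  ¬Adjacent⇒≢centre {c} c≢c′ ¬adjacent c′≡centre =
    ¬adjacent (subst (Adjacent c) (sym c′≡centre) (Adjacent-centre λ c≡centre → c≢c′ (trans c≡centre (sym c′≡centre))))

  code-Dist : ∀ c c′ → Dist graph (vertex (inj₂ c)) (vertex (inj₂ c′)) (δ (inj₂ c) (inj₂ c′))
  code-Dist c c′ with c ≟ c′ | adjacent? c c′
  ... | yes refl | _ = Dist-refl graph
  ... | no c≢c′ | yes adjacent =
    Dist-adj graph (c≢c′ ∘ inj₂-injective ∘ join-injective k (3 ^ k)) (Edge⇒adj (inj₂ c) (inj₂ c′) adjacent)
  ... | no c≢c′ | no ¬adjacent =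
    Dist-common-neighbour graph (c≢c′ ∘ inj₂-injective ∘ join-injective k (3 ^ k))
      (¬Edge⇒¬adj (inj₂ c) (inj₂ c′) ¬adjacent)
      (Edge⇒adj (inj₂ c) (inj₂ centre) (Adjacent-centre (¬Adjacent⇒≢centre (≢-sym c≢c′) (¬adjacent ∘ Adjacent-sym))))
      (Edge⇒adj (inj₂ centre) (inj₂ c′) (Adjacent-sym (Adjacent-centre (¬Adjacent⇒≢centre c≢c′ ¬adjacent))))

  vertex-Dist : ∀ x y → Dist graph (vertex x) (vertex y) (δ x y)
  vertex-Dist (inj₁ i) y = landmark-Dist i y
  vertex-Dist (inj₂ c) (inj₁ i) = Dist-sym graph (landmark-Dist i (inj₂ c))
  vertex-Dist (inj₂ c) (inj₂ c′) = code-Dist c c′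

  distance : Fin (k + 3 ^ k) → Fin (k + 3 ^ k) → ℕ
  distance u v = δ (view u) (view v)

  dist : ∀ u v → Dist graph u v (distance u v)
  dist u v = subst₂ (λ a b → Dist graph a b (distance u v))
                    (sym (view⇒≡vertex refl)) (sym (view⇒≡vertex refl)) (vertex-Dist (view u) (view v))

  open DistanceFunction graph distance dist public

  δ-codes≤2 : ∀ c c′ → δ (inj₂ c) (inj₂ c′) ≤ 2
  δ-codes≤2 c c′ with c ≟ c′ | adjacent? c c′
  ... | yes _ | _ = z≤n
  ... | no _ | yes _ = s≤s z≤n
  ... | no _ | no _ = ≤-refl

  δ≤3 : ∀ x y → δ x y ≤ 3
  δ≤3 (inj₁ i) (inj₁ j) with i ≟ j
  ... | yes _ = z≤n
  ... | no _ = s≤s (s≤s z≤n)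
  δ≤3 (inj₁ i) (inj₂ c) = toℕ<n (coord c i)
  δ≤3 (inj₂ c) (inj₁ i) = toℕ<n (coord c i)
  δ≤3 (inj₂ c) (inj₂ c′) = m≤n⇒m≤1+n (δ-codes≤2 c c′)

  distance≤3 : ∀ u v → distance u v ≤ 3
  distance≤3 u v = δ≤3 (view u) (view v)

  diameter-3 : Fin k → HasDiameter graph 3
  diameter-3 i =
    (λ u v m d → subst (_≤ 3) (sym (Dist⇒≡δ d)) (distance≤3 u v)) ,
    landmark i , vertex (inj₂ far) ,
    subst (Dist graph _ _) (cong (suc ∘ toℕ) (coord-constant _ i)) (landmark-Dist i (inj₂ far))
    where
    far = constant (suc (suc zero))

  landmarks : Subset (k + 3 ^ k)
  landmarks = ⊤ {k} ++ ∅

  ∣landmarks∣ : ∣ landmarks ∣ ≡ k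
  ∣landmarks∣ = ∣⊤++∅∣ k (3 ^ k)

  landmark∈landmarks : ∀ i → landmark i ∈ landmarks
  landmark∈landmarks i = ↑ˡ∈⊤++ i (∅ {3 ^ k})

  landmarks-resolving : Resolving graph landmarks
  landmarks-resolving = δ-Resolving⇒Resolving separate
    where
    separate : δ-Resolving landmarks
    separate u v agree = by-cases (view u) refl (view v) refl
      where
      by-cases : ∀ x → view u ≡ x → ∀ y → view v ≡ y → u ≡ v
      by-cases (inj₁ i) eu _ _ = sym (δ≡0⇒≡ (trans (sym (agree u u∈)) (δ-refl u)))
        where u∈ = subst (_∈ landmarks) (sym (view⇒≡vertex eu)) (landmark∈landmarks i)
      by-cases (inj₂ _) _ (inj₁ j) ev = δ≡0⇒≡ (trans (agree v v∈) (δ-refl v))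
        where v∈ = subst (_∈ landmarks) (sym (view⇒≡vertex ev)) (landmark∈landmarks j)
      by-cases (inj₂ c) eu (inj₂ c′) ev = begin
        u                  ≡⟨ view⇒≡vertex eu ⟩
        vertex (inj₂ c)    ≡⟨ cong (vertex ∘ inj₂) (finToFun-injective same-coords) ⟩
        vertex (inj₂ c′)   ≡⟨ sym (view⇒≡vertex ev) ⟩
        v                  ∎
        where
        open ≡-Reasoning
        same-coords : ∀ i → coord c i ≡ coord c′ i
        same-coords i = toℕ-injective (suc-injective (begin
          δ (inj₂ c) (inj₁ i)       ≡⟨ cong₂ δ (sym eu) (sym (view-vertex (inj₁ i))) ⟩
          distance u (landmark i)   ≡⟨ agree _ (landmark∈landmarks i) ⟩
          distance v (landmark i)   ≡⟨ cong₂ δ ev (view-vertex (inj₁ i)) ⟩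
          δ (inj₂ c′) (inj₁ i)      ∎))

  resolving-size : ∀ {W} → Resolving graph W → k ≤ ∣ W ∣
  resolving-size {W} resolving = m+3^m≤n+3^n⇒m≤n (Diameter≤3.order≤ distance≤3 W resolving)

  landmarks-basis : MetricBasis graph landmarks
  landmarks-basis = landmarks-resolving , λ W resolving → ≤-trans (≤-reflexive ∣landmarks∣) (resolving-size resolving)

  far-from-code⇒landmark : ∀ {w c} → view w ≡ inj₂ c → ∀ v → distance v w ≡ 3 → ∃[ j ] landmark j ≡ v
  far-from-code⇒landmark {w} {c} ew v far with view v in ev
  ... | inj₁ j = j , sym (view⇒≡vertex ev)
  ... | inj₂ c′ with s≤s (s≤s ()) ← subst (_≤ 2) (trans (cong (δ (inj₂ c′)) (sym ew)) far) (δ-codes≤2 c′ c)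

  basis-unique : 2 ≤ k → ∀ W → MetricBasis graph W → W ≡ landmarks
  basis-unique 2≤k W (resolving , minimum) = ⊆∧∣⊇∣⇒≡ W⊆landmarks (≤-reflexive (trans ∣landmarks∣ (sym ∣W∣≡k)))
    where
    ∣W∣≡k : ∣ W ∣ ≡ k
    ∣W∣≡k = ≤-antisym (≤-trans (minimum landmarks landmarks-resolving) (≤-reflexive ∣landmarks∣))
                      (resolving-size resolving)
    W⊆landmarks : W ⊆ landmarks
    W⊆landmarks {w} w∈W with view w in ew
    ... | inj₁ i = subst (_∈ landmarks) (sym (view⇒≡vertex ew)) (landmark∈landmarks i)
    ... | inj₂ c = contradiction few-landmarks (<⇒≱ (n<3^pred[n] 2≤k))
      where
      few-landmarks : 3 ^ pred k ≤ k
      few-landmarks = subst (λ b → 3 ^ pred b ≤ k) ∣W∣≡k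
        (Diameter≤3.far-from-member-bound distance≤3 W resolving
          (cong (λ b → b + 3 ^ b) (sym ∣W∣≡k)) w∈W landmark (far-from-code⇒landmark ew))

theorem5 : (k : ℕ) → 2 ≤ k →
    ∃[ G ] (Connected {k + 3 ^ k} G × HasDiameter G 3 × MetricDimension G k × UniqueMetricBasis G)
theorem5 k@(suc _) 2≤k =
  graph , connected , diameter-3 zero ,
  (landmarks , landmarks-basis , ∣landmarks∣) , (landmarks , landmarks-basis , basis-unique 2≤k)
  where open Construction k
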